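{- Let $\mathbb{M}=((M_n)_{n\in\mathbb{N}},\eta,(\mu^{n,k})_{n,k})$ be a depth-1 graded monad on a category $\mathcal{C}$ for which the functor $\overline{M}_1$ on the Eilenberg–Moore category $\mathit{EM}(M_0)$ is defined. Then for every $\mathcal{C}$-morphism $f\colon X\to M_kY$, we have $\overline{M}_1(f^*_0)=f^*_1$, where $f^*_0$ is regarded as an $M_0$-algebra homomorphism $(M_0X,\mu^{0,0}_X)\to(M_kY,\mu^{0,k}_Y)$ and $f^*_1\colon M_1X\to M_{1+k}Y$.
   Context: A graded monad consists of functors $M_n$, natural transformations $\eta\colon\mathit{Id}\to M_0$ and $\mu^{n,k}\colon M_nM_k\to M_{n+k}$ with unit laws $\mu^{0,n}\cdot\eta M_n=\mathit{id}=\mu^{n,0}\cdot M_n\eta$ and associativity $\mu^{n+k,m}\cdot\mu^{n,k}M_m=\mu^{n,k+m}\cdot M_n\mu^{k,m}$. It is depth-1 if for all $n$, $\mu^{1,n}_X$ is a coequalizer of $\mu^{1,0}_{M_nX},\,M_1\mu^{0,n}_X\colon M_1M_0M_nX\to M_1M_nX$. A graded $M_1$-algebra consists of objects $A_0,A_1$ and morphisms $a^{0,0}\colon M_0A_0\to A_0$, $a^{0,1}\colon M_0A_1\to A_1$, $a^{1,0}\colon M_1A_0\to A_1$ with $a^{0,m}\cdot\eta_{A_m}=\mathit{id}$ and $a^{m+r,k}\cdot\mu^{m,r}_{A_k}=a^{m,r+k}\cdot M_ma^{r,k}$ whenever $m+r+k\le 1$; homomorphisms are pairs $(f_0,f_1)$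 with $f_{m+k}\cdot a^{m,k}=b^{m,k}\cdot M_mf_k$. Graded $M_0$-algebras are exactly $M_0$-algebras. The functor $\overline{M}_1\colon\mathit{EM}(M_0)\to\mathit{EM}(M_0)$ is defined (in the setting where it exists) by letting $EA$ be the free graded $M_1$-algebra over the $M_0$-algebra $A$ with respect to the functor taking an $M_1$-algebra to its $0$-part $(A_0,a^{0,0})$, with $0$-part $A$, and setting $\overline{M}_1A=((EA)_1,a^{0,1})$ and, for a homomorphism $g\colon A\to B$, $\overline{M}_1 g$ the $1$-component of $Eg$; for $A=(M_nX,\mu^{0,n}_X)$ one has $\overline{M}_1A=(M_{n+1}X,\mu^{0,n+1}_X)$. The graded Kleisli star of $f\colon X\to M_kY$ is $f^*_n=\mu^{n,k}_Y\cdot M_nf\colon M_nX\to M_{n+k}Y$. -}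

module Defs where

open import Level using (Level; _⊔_) renaming (suc to lsuc)
open import Data.Nat using (ℕ; zero; suc; _+_)
open import Data.Nat.Properties using (+-assoc; +-identityʳ)
open import Data.Product using (Σ; _×_; _,_)
open import Relation.Binary.Structures using (IsEquivalence)
open import Relation.Binary.Bundles using (Setoid)
open import Relation.Binary.PropositionalEquality using (_≡_; refl; sym)
import Relation.Binary.Reasoning.Setoid as SetoidR

record Category (o ℓ e : Level) : Set (lsuc (o ⊔ ℓ ⊔ e)) where
  infixr 9 _∘_
  infix 4 _≈_
  field
    Obj : Set o
    _⇒_ : Obj → Obj → Set ℓ
    _≈_ : ∀ {A B} → (A ⇒ B) → (A ⇒ B) → Set e
    id : ∀ {A} → A ⇒ A
    _∘_ : ∀ {A B C} → B ⇒ C → A ⇒ B → A ⇒ C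
    ≈-equiv : ∀ {A B} → IsEquivalence (_≈_ {A} {B})
    assoc : ∀ {A B C D} {f : A ⇒ B} {g : B ⇒ C} {h : C ⇒ D} →
            (h ∘ g) ∘ f ≈ h ∘ (g ∘ f)
    identityˡ : ∀ {A B} {f : A ⇒ B} → id ∘ f ≈ f
    identityʳ : ∀ {A B} {f : A ⇒ B} → f ∘ id ≈ f
    ∘-resp-≈ : ∀ {A B C} {f h : B ⇒ C} {g i : A ⇒ B} →
               f ≈ h → g ≈ i → f ∘ g ≈ h ∘ i

  hom-setoid : Obj → Obj → Setoid ℓ e
  hom-setoid A B = record { Carrier = A ⇒ B ; _≈_ = _≈_ ; isEquivalence = ≈-equiv }

module _ {o ℓ e : Level} (C : Category o ℓ e) where
  open Category C

  record Endofunctor : Set (o ⊔ ℓ ⊔ e) where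
    field
      F₀ : Obj → Obj
      F₁ : ∀ {A B} → A ⇒ B → F₀ A ⇒ F₀ B
      identity : ∀ {A} → F₁ (id {A}) ≈ id
      homomorphism : ∀ {A B D} {f : A ⇒ B} {g : B ⇒ D} →
                     F₁ (g ∘ f) ≈ F₁ g ∘ F₁ f
      F-resp-≈ : ∀ {A B} {f g : A ⇒ B} → f ≈ g → F₁ f ≈ F₁ g

  coe : (M : ℕ → Endofunctor) {a b : ℕ} → a ≡ b → (X : Obj) →
        Endofunctor.F₀ (M a) X ⇒ Endofunctor.F₀ (M b) X
  coe M refl X = id

  record GradedMonad : Set (o ⊔ ℓ ⊔ e) where
    field
      M : ℕ → Endofunctor
    Mo : ℕ → Obj → Obj
    Mo n = Endofunctor.F₀ (M n)
    Mh : ∀ n {X Y} → X ⇒ Y → Mo n X ⇒ Mo n Y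
    Mh n = Endofunctor.F₁ (M n)
    field
      η : ∀ X → X ⇒ Mo 0 X
      μ : ∀ n k X → Mo n (Mo k X) ⇒ Mo (n + k) X
      η-natural : ∀ {X Y} (h : X ⇒ Y) → Mh 0 h ∘ η X ≈ η Y ∘ h
      μ-natural : ∀ n k {X Y} (h : X ⇒ Y) →
                  Mh (n + k) h ∘ μ n k X ≈ μ n k Y ∘ Mh n (Mh k h)
      unitˡ : ∀ n X → μ 0 n X ∘ η (Mo n X) ≈ id
      unitʳ : ∀ n X → μ n 0 X ∘ Mh n (η X) ≈ coe M (sym (+-identityʳ n)) X
      μ-assoc : ∀ n k m X →
                coe M (+-assoc n k m) X ∘ (μ (n + k) m X ∘ μ n k (Mo m X))
                  ≈ μ n (k + m) X ∘ Mh n (μ k m X)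

  record IsCoequalizer {A B E : Obj} (f g : A ⇒ B) (q : B ⇒ E) : Set (o ⊔ ℓ ⊔ e) where
    field
      equality : q ∘ f ≈ q ∘ g
      coequalize : ∀ {Z} (h : B ⇒ Z) → h ∘ f ≈ h ∘ g → E ⇒ Z
      universal : ∀ {Z} (h : B ⇒ Z) (p : h ∘ f ≈ h ∘ g) → coequalize h p ∘ q ≈ h
      unique : ∀ {Z} (h : B ⇒ Z) (p : h ∘ f ≈ h ∘ g) (u : E ⇒ Z) →
               u ∘ q ≈ h → u ≈ coequalize h p

module _ {o ℓ e : Level} {C : Category o ℓ e} (T : GradedMonad C) where
  open Category C
  open GradedMonad T

  Depth1 : Set (o ⊔ ℓ ⊔ e)
  Depth1 = ∀ n X → IsCoequalizer C (μ 1 0 (Mo n X)) (Mh 1 (μ 0 n X)) (μ 1 n X)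

  star : ∀ n {k X Y} → X ⇒ Mo k Y → Mo n X ⇒ Mo (n + k) Y
  star n {k} {X} {Y} f = μ n k Y ∘ Mh n f

  record M0Alg : Set (o ⊔ ℓ ⊔ e) where
    field
      Carrier : Obj
      act : Mo 0 Carrier ⇒ Carrier
      act-unit : act ∘ η Carrier ≈ id
      act-assoc : act ∘ μ 0 0 Carrier ≈ act ∘ Mh 0 act

  IsM0Hom : (A B : M0Alg) → M0Alg.Carrier A ⇒ M0Alg.Carrier B → Set e
  IsM0Hom A B g = g ∘ M0Alg.act A ≈ M0Alg.act B ∘ Mh 0 g

  record M0Hom (A B : M0Alg) : Set (ℓ ⊔ e) where
    field
      hom : M0Alg.Carrier A ⇒ M0Alg.Carrier B
      isHom : IsM0Hom A B hom

  record RawGAlg : Set (o ⊔ ℓ) where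
    field
      A₀ A₁ : Obj
      a00 : Mo 0 A₀ ⇒ A₀
      a01 : Mo 0 A₁ ⇒ A₁
      a10 : Mo 1 A₀ ⇒ A₁

  -- the laws, for all m + r + k ≤ 1
  record IsGAlg (A : RawGAlg) : Set e where
    open RawGAlg A
    field
      unit0 : a00 ∘ η A₀ ≈ id
      unit1 : a01 ∘ η A₁ ≈ id
      assoc000 : a00 ∘ μ 0 0 A₀ ≈ a00 ∘ Mh 0 a00
      assoc001 : a01 ∘ μ 0 0 A₁ ≈ a01 ∘ Mh 0 a01
      assoc010 : a10 ∘ μ 0 1 A₀ ≈ a01 ∘ Mh 0 a10
      assoc100 : a10 ∘ μ 1 0 A₀ ≈ a10 ∘ Mh 1 a00

  record GAlg : Set (o ⊔ ℓ ⊔ e) where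
    field
      raw : RawGAlg
      laws : IsGAlg raw
    open RawGAlg raw public

  record IsGHom (A B : RawGAlg) (f₀ : RawGAlg.A₀ A ⇒ RawGAlg.A₀ B)
                (f₁ : RawGAlg.A₁ A ⇒ RawGAlg.A₁ B) : Set e where
    field
      hom00 : f₀ ∘ RawGAlg.a00 A ≈ RawGAlg.a00 B ∘ Mh 0 f₀
      hom01 : f₁ ∘ RawGAlg.a01 A ≈ RawGAlg.a01 B ∘ Mh 0 f₁
      hom10 : f₁ ∘ RawGAlg.a10 A ≈ RawGAlg.a10 B ∘ Mh 1 f₀

  zeroPart : GAlg → M0Alg
  zeroPart B = record
    { Carrier = GAlg.A₀ B
    ; act = GAlg.a00 B
    ; act-unit = IsGAlg.unit0 (GAlg.laws B)
    ; act-assoc = IsGAlg.assoc000 (GAlg.laws B) }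

  record FreeGAlg (A : M0Alg) : Set (o ⊔ ℓ ⊔ e) where
    field
      E₁ : Obj
      e01 : Mo 0 E₁ ⇒ E₁
      e10 : Mo 1 (M0Alg.Carrier A) ⇒ E₁
    rawE : RawGAlg
    rawE = record { A₀ = M0Alg.Carrier A ; A₁ = E₁
                  ; a00 = M0Alg.act A ; a01 = e01 ; a10 = e10 }
    field
      isGAlg : IsGAlg rawE
      ext : (B : GAlg) → M0Hom A (zeroPart B) → E₁ ⇒ GAlg.A₁ B
      ext-hom : (B : GAlg) (h : M0Hom A (zeroPart B)) →
                IsGHom rawE (GAlg.raw B) (M0Hom.hom h) (ext B h)
      ext-unique : (B : GAlg) (h : M0Hom A (zeroPart B)) (f₁ : E₁ ⇒ GAlg.A₁ B) →
                   IsGHom rawE (GAlg.raw B) (M0Hom.hom h) f₁ → f₁ ≈ ext B h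
    asGAlg : GAlg
    asGAlg = record { raw = rawE ; laws = isGAlg }

  -- "the functor M̄₁ on EM(M₀) is defined": free graded M_1-algebras exist
  FreeGAlgs : Set (o ⊔ ℓ ⊔ e)
  FreeGAlgs = (A : M0Alg) → FreeGAlg A

  module _ (F : FreeGAlgs) where
    M̄₁-obj : M0Alg → Obj
    M̄₁-obj A = FreeGAlg.E₁ (F A)

    M̄₁ : {A B : M0Alg} → M0Hom A B → M̄₁-obj A ⇒ M̄₁-obj B
    M̄₁ {A} {B} g = FreeGAlg.ext (F A) (FreeGAlg.asGAlg (F B)) g'
      where
        g' : M0Hom A (zeroPart (FreeGAlg.asGAlg (F B)))
        g' = record { hom = M0Hom.hom g ; isHom = M0Hom.isHom g }

  private
    module R {A B : Obj} = SetoidR (hom-setoid A B)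
    module E {A B : Obj} = IsEquivalence (≈-equiv {A} {B})

  freeM0Alg : ℕ → Obj → M0Alg
  freeM0Alg n X = record
    { Carrier = Mo n X
    ; act = μ 0 n X
    ; act-unit = unitˡ n X
    ; act-assoc = E.trans (E.sym identityˡ) (μ-assoc 0 0 n X) }

  canonRaw : ℕ → Obj → RawGAlg
  canonRaw n X = record { A₀ = Mo n X ; A₁ = Mo (suc n) X
                        ; a00 = μ 0 n X ; a01 = μ 0 (suc n) X ; a10 = μ 1 n X }

  star0-isHom : ∀ {k X Y} (f : X ⇒ Mo k Y) →
                IsM0Hom (freeM0Alg 0 X) (freeM0Alg k Y) (star 0 f)
  star0-isHom {k} {X} {Y} f = begin
      (μ 0 k Y ∘ Mh 0 f) ∘ μ 0 0 X
    ≈⟨ assoc ⟩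
      μ 0 k Y ∘ (Mh 0 f ∘ μ 0 0 X)
    ≈⟨ ∘-resp-≈ E.refl (μ-natural 0 0 f) ⟩
      μ 0 k Y ∘ (μ 0 0 (Mo k Y) ∘ Mh 0 (Mh 0 f))
    ≈⟨ E.sym assoc ⟩
      (μ 0 k Y ∘ μ 0 0 (Mo k Y)) ∘ Mh 0 (Mh 0 f)
    ≈⟨ ∘-resp-≈ (E.trans (E.sym identityˡ) (μ-assoc 0 0 k Y)) E.refl ⟩
      (μ 0 k Y ∘ Mh 0 (μ 0 k Y)) ∘ Mh 0 (Mh 0 f)
    ≈⟨ assoc ⟩
      μ 0 k Y ∘ (Mh 0 (μ 0 k Y) ∘ Mh 0 (Mh 0 f))
    ≈⟨ ∘-resp-≈ E.refl (E.sym (Endofunctor.homomorphism (M 0))) ⟩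
      μ 0 k Y ∘ Mh 0 (μ 0 k Y ∘ Mh 0 f)
    ∎
    where open R

  star0-hom : ∀ {k X Y} (f : X ⇒ Mo k Y) → M0Hom (freeM0Alg 0 X) (freeM0Alg k Y)
  star0-hom f = record { hom = star 0 f ; isHom = star0-isHom f }

{-# OPTIONS --safe #-}
-- Both sides are 1-components of graded M₁-algebra homomorphisms out of the
-- free algebra E(M₀X) into the canonical algebra (M_k Y, M_{k+1} Y) lying over
-- f*₀: the left one is (id , v) ∘ E(f*₀), the right one is (f*₀ , f*₁) ∘ (id , u),
-- the graded Kleisli extension (f*_n , f*_{n+1}) being a homomorphism of
-- canonical algebras by naturality and associativity of μ. The universal
-- property of E(M₀X) makes such a 1-component unique.
module Submission where

open import Level using (Level)
open import Data.Nat using (ℕ; suc; _+_)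
open import Relation.Binary.Structures using (IsEquivalence)
import Relation.Binary.Reasoning.Setoid as SetoidReasoning
open import Defs

module _ {o ℓ e : Level} {C : Category o ℓ e} (T : GradedMonad C) where
  open Category C
  open GradedMonad T

  private
    module ≈ {A B : Obj} = IsEquivalence (≈-equiv {A} {B})
    module HomReasoning {A B : Obj} = SetoidReasoning (hom-setoid A B)

  Mh-∘ : ∀ n {A B D} {f : A ⇒ B} {g : B ⇒ D} → Mh n (g ∘ f) ≈ Mh n g ∘ Mh n f
  Mh-∘ n = Endofunctor.homomorphism (M n)

  Mh-resp-≈ : ∀ n {A B} {f g : A ⇒ B} → f ≈ g → Mh n f ≈ Mh n g
  Mh-resp-≈ n = Endofunctor.F-resp-≈ (M n)

  μ-assoc₀ : ∀ n k X → μ n k X ∘ μ 0 n (Mo k X) ≈ μ 0 (n + k) X ∘ Mh 0 (μ n k X)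
  μ-assoc₀ n k X = ≈.trans (≈.sym identityˡ) (μ-assoc 0 n k X)

  μ-assoc₁ : ∀ n k X → μ (suc n) k X ∘ μ 1 n (Mo k X) ≈ μ 1 (n + k) X ∘ Mh 1 (μ n k X)
  μ-assoc₁ n k X = ≈.trans (≈.sym identityˡ) (μ-assoc 1 n k X)

  Mh-square-paste : ∀ n {P Q S A B D} {x : P ⇒ Q} {y : Q ⇒ S}
                      {a : Mo n A ⇒ P} {b : Mo n B ⇒ Q} {c : Mo n D ⇒ S}
                      {p : A ⇒ B} {q : B ⇒ D} →
                    x ∘ a ≈ b ∘ Mh n p → y ∘ b ≈ c ∘ Mh n q →
                    (y ∘ x) ∘ a ≈ c ∘ Mh n (q ∘ p)
  Mh-square-paste n {x = x} {y} {a} {b} {c} {p} {q} left right = begin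
    (y ∘ x) ∘ a            ≈⟨ assoc ⟩
    y ∘ (x ∘ a)            ≈⟨ ∘-resp-≈ ≈.refl left ⟩
    y ∘ (b ∘ Mh n p)       ≈⟨ ≈.sym assoc ⟩
    (y ∘ b) ∘ Mh n p       ≈⟨ ∘-resp-≈ right ≈.refl ⟩
    (c ∘ Mh n q) ∘ Mh n p  ≈⟨ assoc ⟩
    c ∘ (Mh n q ∘ Mh n p)  ≈⟨ ∘-resp-≈ ≈.refl (≈.sym (Mh-∘ n)) ⟩
    c ∘ Mh n (q ∘ p)       ∎
    where open HomReasoning

  IsGHom-∘ : ∀ {A B D : RawGAlg T} {f₀ f₁ g₀ g₁} →
             IsGHom T A B f₀ f₁ → IsGHom T B D g₀ g₁ →
             IsGHom T A D (g₀ ∘ f₀) (g₁ ∘ f₁)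
  IsGHom-∘ f g = record
    { hom00 = Mh-square-paste 0 (IsGHom.hom00 f) (IsGHom.hom00 g)
    ; hom01 = Mh-square-paste 0 (IsGHom.hom01 f) (IsGHom.hom01 g)
    ; hom10 = Mh-square-paste 1 (IsGHom.hom10 f) (IsGHom.hom10 g) }

  IsGHom-resp-≈ : ∀ {A B : RawGAlg T} {f₀ f₁ g₀ g₁} → f₀ ≈ g₀ → f₁ ≈ g₁ →
                  IsGHom T A B f₀ f₁ → IsGHom T A B g₀ g₁
  IsGHom-resp-≈ f₀≈g₀ f₁≈g₁ f = record
    { hom00 = transport f₀≈g₀ (Mh-resp-≈ 0 f₀≈g₀) (IsGHom.hom00 f)
    ; hom01 = transport f₁≈g₁ (Mh-resp-≈ 0 f₁≈g₁) (IsGHom.hom01 f)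
    ; hom10 = transport f₁≈g₁ (Mh-resp-≈ 1 f₀≈g₀) (IsGHom.hom10 f) }
    where
    transport : ∀ {P Q R S} {x x′ : Q ⇒ S} {y y′ : P ⇒ R} {a : P ⇒ Q} {b : R ⇒ S} →
                x ≈ x′ → y ≈ y′ → x ∘ a ≈ b ∘ y → x′ ∘ a ≈ b ∘ y′
    transport x≈x′ y≈y′ sq =
      ≈.trans (∘-resp-≈ (≈.sym x≈x′) ≈.refl) (≈.trans sq (∘-resp-≈ ≈.refl y≈y′))

  canonGAlg : ℕ → Obj → GAlg T
  canonGAlg n X = record
    { raw = canonRaw T n X
    ; laws = record
      { unit0 = unitˡ n X
      ; unit1 = unitˡ (suc n) X
      ; assoc000 = μ-assoc₀ 0 n X
      ; assoc001 = μ-assoc₀ 0 (suc n) X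
      ; assoc010 = μ-assoc₀ 1 n X
      ; assoc100 = μ-assoc₁ 0 n X } }

  star-isGHom : ∀ n {k X Y} (f : X ⇒ Mo k Y) →
                IsGHom T (canonRaw T n X) (canonRaw T (n + k) Y) (star T n f) (star T (suc n) f)
  star-isGHom n {k} {X} {Y} f = record
    { hom00 = Mh-square-paste 0 (μ-natural 0 n f) (μ-assoc₀ n k Y)
    ; hom01 = Mh-square-paste 0 (μ-natural 0 (suc n) f) (μ-assoc₀ (suc n) k Y)
    ; hom10 = Mh-square-paste 1 (μ-natural 1 n f) (μ-assoc₁ n k Y) }

  free-ext-unique : ∀ {A} (E : FreeGAlg T A) (B : GAlg T) (h : M0Hom T A (zeroPart T B))
                    {f₁ g₁ : FreeGAlg.E₁ E ⇒ GAlg.A₁ B} →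
                    IsGHom T (FreeGAlg.rawE E) (GAlg.raw B) (M0Hom.hom h) f₁ →
                    IsGHom T (FreeGAlg.rawE E) (GAlg.raw B) (M0Hom.hom h) g₁ →
                    f₁ ≈ g₁
  free-ext-unique E B h f g =
    ≈.trans (FreeGAlg.ext-unique E B h _ f) (≈.sym (FreeGAlg.ext-unique E B h _ g))

  M̄₁-isGHom : (F : FreeGAlgs T) {A B : M0Alg T} (g : M0Hom T A B) →
              IsGHom T (FreeGAlg.rawE (F A)) (FreeGAlg.rawE (F B)) (M0Hom.hom g) (M̄₁ T F g)
  M̄₁-isGHom F {A} {B} g =
    FreeGAlg.ext-hom (F A) (FreeGAlg.asGAlg (F B))
      record { hom = M0Hom.hom g ; isHom = M0Hom.isHom g }

lemma4p4 : ∀ {o ℓ e : Level} {C : Category o ℓ e} (T : GradedMonad C) →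
    Depth1 T → (F : FreeGAlgs T) →
    ∀ {k : ℕ} {X Y : Category.Obj C} (f : Category._⇒_ C X (GradedMonad.Mo T k Y)) →
    -- identifications M̄₁(M_0 X, μ^{0,0}) ≅ M_1 X and M̄₁(M_k Y, μ^{0,k}) ≅ M_{1+k} Y
    -- given by the canonical comparison homomorphisms (id , u) and (id , v)
    (u : Category._⇒_ C (M̄₁-obj T F (freeM0Alg T 0 X)) (GradedMonad.Mo T 1 X)) →
    IsGHom T (FreeGAlg.rawE (F (freeM0Alg T 0 X))) (canonRaw T 0 X) (Category.id C) u →
    (v : Category._⇒_ C (M̄₁-obj T F (freeM0Alg T k Y)) (GradedMonad.Mo T (suc k) Y)) →
    IsGHom T (FreeGAlg.rawE (F (freeM0Alg T k Y))) (canonRaw T k Y) (Category.id C) v →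
    Category._≈_ C
      (Category._∘_ C v (M̄₁ T F (star0-hom T f)))
      (Category._∘_ C (star T 1 f) u)
-- Depth-1 is what makes u and v isomorphisms in the paper; given them as
-- hypotheses, the equation follows from freeness alone.
lemma4p4 {C = C} T _ F {k} {X} {Y} f u u-hom v v-hom =
  free-ext-unique T (F (freeM0Alg T 0 X)) (canonGAlg T k Y) f*₀
    (IsGHom-resp-≈ T identityˡ refl (IsGHom-∘ T (M̄₁-isGHom T F (star0-hom T f)) v-hom))
    (IsGHom-resp-≈ T identityʳ refl (IsGHom-∘ T u-hom (star-isGHom T 0 f)))
  where
  open Category C
  open IsEquivalence ≈-equiv using (refl)

  f*₀ : M0Hom T (freeM0Alg T 0 X) (zeroPart T (canonGAlg T k Y))
  f*₀ = record { hom = star T 0 f ; isHom = star0-isHom T f }
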